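{- Let $(\Sigma,P)$ be a string rewrite system. If two proof terms $\gamma$ and $\delta$ are permutation equivalent, then their trace graphs $[\![\gamma]\!]$ and $[\![\delta]\!]$ are the same up to graph isomorphism.
   Context: An alphabet $\Sigma$ has unique reading; strings are elements of the free monoid over $\Sigma$ with empty string $\varepsilon$. A string rewrite system $(\Sigma,P)$ has rules $\varrho:\ell\to r$ with $\ell,r$ nonempty strings. Proof terms are built from $\varepsilon$, letters, rule symbols, juxtaposition $\gamma\delta$ and vertical composition $\gamma\cdot\delta$, with sources and targets $\gamma:s\Rightarrow t$ given by: $\varepsilon:\varepsilon\Rightarrow\varepsilon$; $a:a\Rightarrow a$; $\varrho:\ell\Rightarrow r$; $\gamma_1\gamma_2:s_1s_2\Rightarrow t_1t_2$ if $\gamma_i:s_i\Rightarrow t_i$; $\gamma\cdot\delta:s\Rightarrow u$ if $\gamma:s\Rightarrow t,\ \delta:t\Rightarrow u$. Permutation equivalence is the congruence on proof terms generated by (with both sides required to be proof terms) $\varepsilon\gamma=\gamma$, $\gamma\varepsilon=\gamma$, $(\gamma\delta)\zeta=\gamma(\delta\zeta)$, $s\cdot\gamma=\gamma$, $\gamma\cdot t=\gamma$ (for strings $s,t$), $(\gamma\cdot\delta)\cdot\zeta=\gamma\cdot(\delta\cdot\zeta)$, and $\gamma\delta\cdot\zeta\eta=(\gamma\cdot\zeta)(\delta\cdot\eta)$. Trace graphs (tragrs). A tragr from string $s$ to string $t$ is a finite planar directed acyclic port graph whose nodes have ordered (clockwise) typed input and output ports, edges going from an output port to an input port of the same type, consisting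 of three parts: (1) the source chain of $s=b_1\cdots b_n$: a node labelled $b_i$ for each letter occurrence, each with an input port of type $\ast$, an output port of type $\ast$ and an output port of type $b_i$, linked in a line by $\ast$-edges and terminated by a node labelled $\varepsilon$ with an input port of type $\ast$ and an output port of type $\varepsilon$; (2) the causal graph: nodes labelled by rule symbols $\varrho:\ell\to r$, with the letters of $\ell$ as input ports and the letters of the reverse of $r$ as output ports, each port typed by its letter; (3) the target chain of $t$, as for $s$ but with the $\ast$ input/output ports swapped (running in reverse direction). Exactly two ports are left unconnected, both of type $\ast$: the first input port of the source chain and the first output port of the target chain. The interpretation $[\![\cdot]\!]$ of a proof term $\gamma:s\Rightarrow t$ as a tragr from $s$ to $t$: $[\![a]\!]$ and $[\![\varepsilon]\!]$ are the ladders on $a$ resp. $\varepsilon$ (source and target chains, with each letter port of the source chain connected to the corresponding letter port of the target chain, empty causal graph); $[\![\varrho]\!]$ for $\varrho:\ell\to r$ consists of the source chain of $\ell$, the target chain of $r$ and a single rule node whose input ports are connected in order to the letter ports of the source chain and whose output ports are connected in order to the letter ports of the target chain; $[\![\gamma\delta]\!]$ is obtained by removing the $\varepsilon$-terminator nodes of the chains of $[\![\gamma]\!]$ and redirecting the corresponding $\ast$-edges to the first nodes of the chains of $[\![\delta]\!]$ (parallel composition); $[\![\gamma\cdot\delta]\!]$ is obtained by connecting the target chain (output) of $[\![\gamma]\!]$ to the source chain (input) of $[\![\delta]\!]$ and then eliding this intermediate interface: each pair consisting of a target-chain node of $[\![\gamma]\!]$ labelled $a$ and the matching source-chain node of $[\![\delta]\!]$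 labelled $a$ is removed, the incoming $a$-edge of the former being joined with the outgoing $a$-edge of the latter (and the $\varepsilon$-nodes likewise removed). -}

module Defs where

open import Data.Nat using (ℕ; zero; suc; _∸_)
open import Data.Fin using (Fin; zero; suc; toℕ)
open import Data.List using (List; []; _∷_; _++_; length; lookup; reverse; map)
open import Data.Product using (Σ; _×_; _,_; ∃)
open import Data.Sum using (_⊎_; inj₁; inj₂; [_,_]; map₁)
open import Data.Unit using (⊤; tt)
open import Data.Empty using (⊥)
open import Relation.Binary.PropositionalEquality using (_≡_)
open import Relation.Nullary using (¬_)
open import Function.Bundles using (_↔_; _⇔_; Inverse)

record SRS : Set₁ where
  field
    Letter       : Set
    Rule         : Set
    lhs rhs      : Rule → List Letter
    lhs-nonempty : ∀ ρ → ¬ (lhs ρ ≡ [])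
    rhs-nonempty : ∀ ρ → ¬ (rhs ρ ≡ [])

-- Ports of a node are addressed by their position (ℕ) in the ordered
-- list of input resp. output ports determined by the node's label.

module Theory (S : SRS) where
  open SRS S

  Str : Set
  Str = List Letter

  data Kind : Set where
    srcN  : Letter → Kind
    srcE  : Kind
    ruleN : Rule → Kind
    tgtN  : Letter → Kind
    tgtE  : Kind

  data PType : Set where
    star : PType
    eps  : PType
    ltrT : Letter → PType

  -- ordered (clockwise) input and output port types of each kind of node
  inPorts outPorts : Kind → List PType
  inPorts  (srcN a)  = star ∷ []
  inPorts  srcE      = star ∷ []
  inPorts  (ruleN ρ) = map ltrT (lhs ρ)
  inPorts  (tgtN a)  = star ∷ ltrT a ∷ []
  inPorts  tgtE      = eps ∷ []
  outPorts (srcN a)  = star ∷ ltrT a ∷ []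
  outPorts srcE      = eps ∷ []
  outPorts (ruleN ρ) = map ltrT (reverse (rhs ρ))
  outPorts (tgtN a)  = star ∷ []
  outPorts tgtE      = star ∷ []

  record PortGraph : Set₁ where
    field
      Node : Set
      kind : Node → Kind
      -- Edge (v , i) (w , j): an edge from output port i of v to input port j of w
      Edge : Node × ℕ → Node × ℕ → Set

  open PortGraph

  record _≅ᴳ_ (G H : PortGraph) : Set where
    field
      φ         : Node G ↔ Node H
      kind-pres : ∀ v → kind H (Inverse.to φ v) ≡ kind G v
      edge-pres : ∀ v i w j →
                  Edge G (v , i) (w , j) ⇔ Edge H (Inverse.to φ v , i) (Inverse.to φ w , j)

  infixl 7 _⊗_
  infixl 6 _⊙_

  data PT : Set where
    ε   : PT
    ltr : Letter → PT
    rul : Rule → PT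
    _⊗_ : PT → PT → PT
    _⊙_ : PT → PT → PT

  data _∶_⇒_ : PT → Str → Str → Set where
    ε∶   : ε ∶ [] ⇒ []
    ltr∶ : ∀ a → ltr a ∶ (a ∷ []) ⇒ (a ∷ [])
    rul∶ : ∀ ρ → rul ρ ∶ lhs ρ ⇒ rhs ρ
    ⊗∶   : ∀ {γ δ s₁ t₁ s₂ t₂} → γ ∶ s₁ ⇒ t₁ → δ ∶ s₂ ⇒ t₂ →
           (γ ⊗ δ) ∶ (s₁ ++ s₂) ⇒ (t₁ ++ t₂)
    ⊙∶   : ∀ {γ δ s t u} → γ ∶ s ⇒ t → δ ∶ t ⇒ u → (γ ⊙ δ) ∶ s ⇒ u

  IsProofTerm : PT → Set
  IsProofTerm γ = ∃ λ s → ∃ λ t → γ ∶ s ⇒ t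

  data IsString : PT → Set where
    ε   : IsString ε
    ltr : ∀ a → IsString (ltr a)
    _⊗_ : ∀ {γ δ} → IsString γ → IsString δ → IsString (γ ⊗ δ)

  data PermAx : PT → PT → Set where
    unitˡ    : ∀ γ → PermAx (ε ⊗ γ) γ
    unitʳ    : ∀ γ → PermAx (γ ⊗ ε) γ
    ⊗-assoc  : ∀ γ δ ζ → PermAx ((γ ⊗ δ) ⊗ ζ) (γ ⊗ (δ ⊗ ζ))
    idˡ      : ∀ {σ} γ → IsString σ → PermAx (σ ⊙ γ) γ
    idʳ      : ∀ {σ} γ → IsString σ → PermAx (γ ⊙ σ) γ
    ⊙-assoc  : ∀ γ δ ζ → PermAx ((γ ⊙ δ) ⊙ ζ) (γ ⊙ (δ ⊙ ζ))
    exchange : ∀ γ δ ζ η → PermAx ((γ ⊗ δ) ⊙ (ζ ⊗ η)) ((γ ⊙ ζ) ⊗ (δ ⊙ η))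

  infix 4 _≈ₚ_
  data _≈ₚ_ : PT → PT → Set where
    ax     : ∀ {γ δ} → PermAx γ δ → IsProofTerm γ → IsProofTerm δ → γ ≈ₚ δ
    refl   : ∀ {γ} → IsProofTerm γ → γ ≈ₚ γ
    sym    : ∀ {γ δ} → γ ≈ₚ δ → δ ≈ₚ γ
    trans  : ∀ {γ δ ζ} → γ ≈ₚ δ → δ ≈ₚ ζ → γ ≈ₚ ζ
    ⊗-cong : ∀ {γ γ' δ δ'} → γ ≈ₚ γ' → δ ≈ₚ δ' →
             IsProofTerm (γ ⊗ δ) → IsProofTerm (γ' ⊗ δ') → γ ⊗ δ ≈ₚ γ' ⊗ δ'
    ⊙-cong : ∀ {γ γ' δ δ'} → γ ≈ₚ γ' → δ ≈ₚ δ' →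
             IsProofTerm (γ ⊙ δ) → IsProofTerm (γ' ⊙ δ') → γ ⊙ δ ≈ₚ γ' ⊙ δ'

  -- A tragr from s to t consists of the
  -- source chain of s, a set of rule nodes, and the target chain of t; the
  -- chain edges (∗- and ε-edges) are determined by s and t, so the data is
  -- the rule nodes and, for every letter input port (letter port of the
  -- target chain or input port of a rule node), the letter output port
  -- (letter port of the source chain or output port of a rule node) it is
  -- connected to.  Rule output ports are indexed by positions in r (the
  -- port list itself is the reverse of r, see outPorts / outPort below).

  In : ∀ {R : Set} → Str → (R → Rule) → Set
  In {R} t lab = Fin (length t) ⊎ Σ R (λ v → Fin (length (lhs (lab v))))

  Out : ∀ {R : Set} → Str → (R → Rule) → Set
  Out {R} s lab = Fin (length s) ⊎ Σ R (λ v → Fin (length (rhs (lab v))))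

  record Tragr (s t : Str) : Set₁ where
    field
      RNode : Set
      lab   : RNode → Rule
      wire  : In t lab → Out s lab

  open Tragr

  data TNode (s t : Str) (R : Set) : Set where
    src    : Fin (length s) → TNode s t R
    srcEnd : TNode s t R
    node   : R → TNode s t R
    tgt    : Fin (length t) → TNode s t R
    tgtEnd : TNode s t R

  module AsPortGraph {s t : Str} (T : Tragr s t) where
    N : Set
    N = TNode s t (RNode T)

    kindT : N → Kind
    kindT (src i)  = srcN (lookup s i)
    kindT srcEnd   = srcE
    kindT (node v) = ruleN (lab T v)
    kindT (tgt j)  = tgtN (lookup t j)
    kindT tgtEnd   = tgtE

    inPort : In t (lab T) → N × ℕ
    inPort (inj₁ j)       = tgt j , 1
    inPort (inj₂ (v , i)) = node v , toℕ i

    outPort : Out s (lab T) → N × ℕ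
    outPort (inj₁ i)       = src i , 1
    outPort (inj₂ (v , o)) = node v , (length (rhs (lab T v)) ∸ suc (toℕ o))

    data TEdge : N × ℕ → N × ℕ → Set where
      srcStep : ∀ i j → suc (toℕ i) ≡ toℕ j → TEdge (src i , 0) (src j , 0)
      srcLast : ∀ i → suc (toℕ i) ≡ length s → TEdge (src i , 0) (srcEnd , 0)
      epsEdge : TEdge (srcEnd , 0) (tgtEnd , 0)
      tgtLast : ∀ j → suc (toℕ j) ≡ length t → TEdge (tgtEnd , 0) (tgt j , 0)
      tgtStep : ∀ i j → suc (toℕ i) ≡ toℕ j → TEdge (tgt j , 0) (tgt i , 0)
      wireE   : ∀ x → TEdge (outPort (wire T x)) (inPort x)

    graph : PortGraph
    graph = record { Node = N ; kind = kindT ; Edge = TEdge }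

  toPG : ∀ {s t} → Tragr s t → PortGraph
  toPG T = AsPortGraph.graph T

  splitPos : ∀ (s₁ s₂ : Str) → Fin (length (s₁ ++ s₂)) → Fin (length s₁) ⊎ Fin (length s₂)
  splitPos []       s₂ i       = inj₂ i
  splitPos (a ∷ s₁) s₂ zero    = inj₁ zero
  splitPos (a ∷ s₁) s₂ (suc i) = map₁ suc (splitPos s₁ s₂ i)

  injL : ∀ (s₁ s₂ : Str) → Fin (length s₁) → Fin (length (s₁ ++ s₂))
  injL (a ∷ s₁) s₂ zero    = zero
  injL (a ∷ s₁) s₂ (suc i) = suc (injL s₁ s₂ i)

  injR : ∀ (s₁ s₂ : Str) → Fin (length s₂) → Fin (length (s₁ ++ s₂))
  injR []       s₂ i = i
  injR (a ∷ s₁) s₂ i = suc (injR s₁ s₂ i)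

  par : ∀ {s₁ t₁ s₂ t₂} → Tragr s₁ t₁ → Tragr s₂ t₂ → Tragr (s₁ ++ s₂) (t₁ ++ t₂)
  par {s₁} {t₁} {s₂} {t₂} G H =
    record { RNode = RNode G ⊎ RNode H ; lab = [ lab G , lab H ] ; wire = w }
    where
      L : Out s₁ (lab G) → Out (s₁ ++ s₂) [ lab G , lab H ]
      L (inj₁ p)       = inj₁ (injL s₁ s₂ p)
      L (inj₂ (v , o)) = inj₂ (inj₁ v , o)
      R : Out s₂ (lab H) → Out (s₁ ++ s₂) [ lab G , lab H ]
      R (inj₁ p)       = inj₁ (injR s₁ s₂ p)
      R (inj₂ (v , o)) = inj₂ (inj₂ v , o)
      w : In (t₁ ++ t₂) [ lab G , lab H ] → Out (s₁ ++ s₂) [ lab G , lab H ]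
      w (inj₁ j) with splitPos t₁ t₂ j
      ... | inj₁ j₁ = L (wire G (inj₁ j₁))
      ... | inj₂ j₂ = R (wire H (inj₁ j₂))
      w (inj₂ (inj₁ v , i)) = L (wire G (inj₂ (v , i)))
      w (inj₂ (inj₂ v , i)) = R (wire H (inj₂ (v , i)))

  -- vertical composition ⟦γ · δ⟧: connect and elide the interface t
  seq : ∀ {s t u} → Tragr s t → Tragr t u → Tragr s u
  seq {s} {t} {u} G H =
    record { RNode = RNode G ⊎ RNode H ; lab = [ lab G , lab H ] ; wire = w }
    where
      L : Out s (lab G) → Out s [ lab G , lab H ]
      L (inj₁ p)       = inj₁ p
      L (inj₂ (v , o)) = inj₂ (inj₁ v , o)
      res : Out t (lab H) → Out s [ lab G , lab H ]
      res (inj₁ p)       = L (wire G (inj₁ p))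
      res (inj₂ (v , o)) = inj₂ (inj₂ v , o)
      w : In u [ lab G , lab H ] → Out s [ lab G , lab H ]
      w (inj₁ j)            = res (wire H (inj₁ j))
      w (inj₂ (inj₁ v , i)) = L (wire G (inj₂ (v , i)))
      w (inj₂ (inj₂ v , i)) = res (wire H (inj₂ (v , i)))

  ⟦_⟧ : ∀ {γ s t} → γ ∶ s ⇒ t → Tragr s t
  ⟦ ε∶ ⟧ = record { RNode = ⊥ ; lab = λ () ; wire = λ { (inj₁ ()) ; (inj₂ (() , _)) } }
  ⟦ ltr∶ a ⟧ = record { RNode = ⊥ ; lab = λ ()
                      ; wire = λ { (inj₁ zero) → inj₁ zero ; (inj₁ (suc ())) ; (inj₂ (() , _)) } }
  ⟦ rul∶ ρ ⟧ = record { RNode = ⊤ ; lab = λ _ → ρ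
                      ; wire = λ { (inj₁ j) → inj₂ (tt , j) ; (inj₂ (tt , i)) → inj₁ i } }
  ⟦ ⊗∶ d e ⟧ = par ⟦ d ⟧ ⟦ e ⟧
  ⟦ ⊙∶ d e ⟧ = seq ⟦ d ⟧ ⟦ e ⟧

  ⟦_⟧ᴳ : ∀ {γ s t} → γ ∶ s ⇒ t → PortGraph
  ⟦ d ⟧ᴳ = toPG ⟦ d ⟧

-- A trace graph from s to t is determined by s, t, its labelled rule nodes and, for
-- every letter input port, the output port wired into it: the chain nodes and the
-- ∗- and ε-edges are fixed by s and t.  Matching exactly these data (_≃ᵀ_) therefore
-- yields a port-graph isomorphism.  This matching is an equivalence and a congruence
-- for parallel and vertical composition, and each generating equation of permutation
-- equivalence holds up to it: both sides have the same rule nodes up to reassociating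
-- disjoint unions (strings contribute none), and their wires agree once the elision of
-- the interface in a vertical composition (resolve) is unfolded.  Since typing
-- derivations are unique, induction on γ ≈ₚ δ concludes.

module Submission where

open import Defs
open import Data.Nat using (ℕ; zero; suc; _+_; _∸_)
open import Data.Nat.Properties using (+-assoc)
open import Data.Fin using (Fin; zero; suc; toℕ; cast)
open import Data.Fin.Properties using (toℕ-injective; toℕ-cast)
open import Data.List using (List; []; _∷_; _++_; length)
open import Data.List.Properties using (++-identityʳ; ++-assoc; length-++)
open import Data.Product using (Σ; _×_; _,_)
open import Data.Sum using (_⊎_; inj₁; inj₂; [_,_]; map; assocʳ)
open import Data.Sum.Algebra using (⊎-cong; ⊎-assoc)
open import Data.Empty using (⊥; ⊥-elim)
open import Function using (_∘_; id)
open import Function.Bundles using (_↔_; Inverse; mk↔ₛ′; mk⇔)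
open import Function.Properties.Inverse using (↔-refl; ↔-sym; ↔-trans)
open import Level using (0ℓ)
open import Relation.Nullary using (¬_)
open import Relation.Binary.PropositionalEquality as ≡
  using (_≡_; refl; cong; cong₂; subst₂; module ≡-Reasoning)
open ≡-Reasoning

private variable
  A B C D X : Set

⊎-identityˡ-empty : ¬ A → (A ⊎ B) ↔ B
⊎-identityˡ-empty ¬a =
  mk↔ₛ′ [ (λ a → ⊥-elim (¬a a)) , id ] inj₂ (λ _ → refl)
        [ (λ a → ⊥-elim (¬a a)) , (λ _ → refl) ]

⊎-identityʳ-empty : ¬ B → (A ⊎ B) ↔ A
⊎-identityʳ-empty ¬b =
  mk↔ₛ′ [ id , (λ b → ⊥-elim (¬b b)) ] inj₁ (λ _ → refl)
        [ (λ _ → refl) , (λ b → ⊥-elim (¬b b)) ]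

⊎-interchange : ((A ⊎ B) ⊎ (C ⊎ D)) ↔ ((A ⊎ C) ⊎ (B ⊎ D))
⊎-interchange = mk↔ₛ′ swap₂₃ swap₂₃ swap₂₃-involutive swap₂₃-involutive
  where
  swap₂₃ : ∀ {A B C D : Set} → (A ⊎ B) ⊎ (C ⊎ D) → (A ⊎ C) ⊎ (B ⊎ D)
  swap₂₃ (inj₁ (inj₁ a)) = inj₁ (inj₁ a)
  swap₂₃ (inj₁ (inj₂ b)) = inj₂ (inj₁ b)
  swap₂₃ (inj₂ (inj₁ c)) = inj₁ (inj₂ c)
  swap₂₃ (inj₂ (inj₂ d)) = inj₂ (inj₂ d)
  swap₂₃-involutive : ∀ {A B C D : Set} (x : (A ⊎ B) ⊎ (C ⊎ D)) → swap₂₃ (swap₂₃ x) ≡ x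
  swap₂₃-involutive (inj₁ (inj₁ a)) = refl
  swap₂₃-involutive (inj₁ (inj₂ b)) = refl
  swap₂₃-involutive (inj₂ (inj₁ c)) = refl
  swap₂₃-involutive (inj₂ (inj₂ d)) = refl

-- An output port of a trace graph with rule nodes R, with every position recorded as a
-- natural number, so that the wirings of trace graphs over strings that are only
-- propositionally equal can be compared by ≡.  unwired is the junk answer for the
-- wire into a nonexistent input port.
data Port (R : Set) : Set where
  unwired  : Port R
  srcPort  : ℕ → Port R
  rulePort : R → ℕ → Port R

mapPort : (A → B) → Port A → Port B
mapPort f unwired        = unwired
mapPort f (srcPort m)    = srcPort m
mapPort f (rulePort v k) = rulePort (f v) k

mapPort-∘ : (g : B → C) (f : A → B) (p : Port A) →
            mapPort g (mapPort f p) ≡ mapPort (g ∘ f) p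
mapPort-∘ g f unwired        = refl
mapPort-∘ g f (srcPort m)    = refl
mapPort-∘ g f (rulePort v k) = refl

mapPort-identity : {f : A → A} → (∀ x → f x ≡ x) → ∀ p → mapPort f p ≡ p
mapPort-identity f≗id unwired        = refl
mapPort-identity f≗id (srcPort m)    = refl
mapPort-identity f≗id (rulePort v k) = cong (λ w → rulePort w k) (f≗id v)

mapPort-inverse : {f : A → B} {g : B → A} → (∀ x → g (f x) ≡ x) →
                  ∀ p → mapPort g (mapPort f p) ≡ p
mapPort-inverse {f = f} {g} g∘f≗id p = ≡.trans (mapPort-∘ g f p) (mapPort-identity g∘f≗id p)

srcPort-injective : ∀ {R m n} → srcPort {R} m ≡ srcPort n → m ≡ n
srcPort-injective refl = refl

rulePort-injective : ∀ {R} {v w : R} {m n} → rulePort v m ≡ rulePort w n → v ≡ w × m ≡ n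
rulePort-injective refl = refl , refl

embedˡ : Port A → Port (A ⊎ B)
embedˡ = mapPort inj₁

embedʳ : ℕ → Port B → Port (A ⊎ B)
embedʳ k unwired        = unwired
embedʳ k (srcPort m)    = srcPort (k + m)
embedʳ k (rulePort v n) = rulePort (inj₂ v) n

mapPort-embedˡ : (f : A → C) (g : B → D) (p : Port A) →
                 mapPort (map f g) (embedˡ p) ≡ embedˡ (mapPort f p)
mapPort-embedˡ f g unwired        = refl
mapPort-embedˡ f g (srcPort m)    = refl
mapPort-embedˡ f g (rulePort v k) = refl

mapPort-embedʳ : (f : A → C) (g : B → D) (k : ℕ) (p : Port B) →
                 mapPort (map f g) (embedʳ k p) ≡ embedʳ k (mapPort g p)
mapPort-embedʳ f g k unwired        = refl
mapPort-embedʳ f g k (srcPort m)    = refl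
mapPort-embedʳ f g k (rulePort v n) = refl

mapPort-assocʳ-embedˡ² : (p : Port A) →
                         mapPort (assocʳ {B = B} {C = C}) (embedˡ (embedˡ p)) ≡ embedˡ p
mapPort-assocʳ-embedˡ² unwired        = refl
mapPort-assocʳ-embedˡ² (srcPort m)    = refl
mapPort-assocʳ-embedˡ² (rulePort v k) = refl

lookupℕ : (xs : List X) → (Fin (length xs) → A) → A → ℕ → A
lookupℕ []       f d n       = d
lookupℕ (x ∷ xs) f d zero    = f zero
lookupℕ (x ∷ xs) f d (suc n) = lookupℕ xs (f ∘ suc) d n

lookupℕ-toℕ : (xs : List X) (f : Fin (length xs) → A) (d : A) (i : Fin (length xs)) →
              lookupℕ xs f d (toℕ i) ≡ f i
lookupℕ-toℕ (x ∷ xs) f d zero    = refl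
lookupℕ-toℕ (x ∷ xs) f d (suc i) = lookupℕ-toℕ xs (f ∘ suc) d i

lookupℕ-beyond : (xs : List X) (f : Fin (length xs) → A) (d : A) (m : ℕ) →
                 lookupℕ xs f d (length xs + m) ≡ d
lookupℕ-beyond []       f d m = refl
lookupℕ-beyond (x ∷ xs) f d m = lookupℕ-beyond xs (f ∘ suc) d m

lookupℕ-natural : (xs : List X) {f : Fin (length xs) → A} {g : Fin (length xs) → B}
                  (h : A → B) (d : A) → (∀ i → g i ≡ h (f i)) →
                  ∀ n → lookupℕ xs g (h d) n ≡ h (lookupℕ xs f d n)
lookupℕ-natural []       h d g≗hf n       = refl
lookupℕ-natural (x ∷ xs) h d g≗hf zero    = g≗hf zero
lookupℕ-natural (x ∷ xs) h d g≗hf (suc n) = lookupℕ-natural xs h d (g≗hf ∘ suc) n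

lookupℕ-agree : (xs : List X) (h₁ h₂ : A → B) (f : Fin (length xs) → A) (d : A) →
                h₁ d ≡ h₂ d → (∀ i → h₁ (f i) ≡ h₂ (f i)) →
                ∀ n → h₁ (lookupℕ xs f d n) ≡ h₂ (lookupℕ xs f d n)
lookupℕ-agree []       h₁ h₂ f d d≡ f≗ n       = d≡
lookupℕ-agree (x ∷ xs) h₁ h₂ f d d≡ f≗ zero    = f≗ zero
lookupℕ-agree (x ∷ xs) h₁ h₂ f d d≡ f≗ (suc n) =
  lookupℕ-agree xs h₁ h₂ (f ∘ suc) d d≡ (f≗ ∘ suc) n

data BelowOrAbove (k : ℕ) : ℕ → Set where
  below : (i : Fin k) → BelowOrAbove k (toℕ i)
  above : (m : ℕ) → BelowOrAbove k (k + m)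

belowOrAbove : ∀ k n → BelowOrAbove k n
belowOrAbove zero    n       = above n
belowOrAbove (suc k) zero    = below zero
belowOrAbove (suc k) (suc n) with belowOrAbove k n
... | below i = below (suc i)
... | above m = above m

module TraceGraphs (S : SRS) where
  open SRS S
  open Theory S
  open Tragr
  open AsPortGraph using (TEdge; srcStep; srcLast; epsEdge; tgtLast; tgtStep; wireE; kindT; outPort)

  lookupℕ-injL : (t₁ t₂ : Str) (f : Fin (length (t₁ ++ t₂)) → A) (d : A) (j : Fin (length t₁)) →
                 lookupℕ (t₁ ++ t₂) f d (toℕ j) ≡ f (injL t₁ t₂ j)
  lookupℕ-injL (a ∷ t₁) t₂ f d zero    = refl
  lookupℕ-injL (a ∷ t₁) t₂ f d (suc j) = lookupℕ-injL t₁ t₂ (f ∘ suc) d j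

  lookupℕ-injR : (t₁ t₂ : Str) (f : Fin (length (t₁ ++ t₂)) → A) (d : A) (m : ℕ) →
                 lookupℕ (t₁ ++ t₂) f d (length t₁ + m) ≡ lookupℕ t₂ (f ∘ injR t₁ t₂) d m
  lookupℕ-injR []       t₂ f d m = refl
  lookupℕ-injR (a ∷ t₁) t₂ f d m = lookupℕ-injR t₁ t₂ (f ∘ suc) d m

  toℕ-injL : (s₁ s₂ : Str) (i : Fin (length s₁)) → toℕ (injL s₁ s₂ i) ≡ toℕ i
  toℕ-injL (a ∷ s₁) s₂ zero    = refl
  toℕ-injL (a ∷ s₁) s₂ (suc i) = cong suc (toℕ-injL s₁ s₂ i)

  toℕ-injR : (s₁ s₂ : Str) (i : Fin (length s₂)) → toℕ (injR s₁ s₂ i) ≡ length s₁ + toℕ i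
  toℕ-injR []       s₂ i = refl
  toℕ-injR (a ∷ s₁) s₂ i = cong suc (toℕ-injR s₁ s₂ i)

  splitPos-injL : (s₁ s₂ : Str) (i : Fin (length s₁)) → splitPos s₁ s₂ (injL s₁ s₂ i) ≡ inj₁ i
  splitPos-injL (a ∷ s₁) s₂ zero    = refl
  splitPos-injL (a ∷ s₁) s₂ (suc i) rewrite splitPos-injL s₁ s₂ i = refl

  splitPos-injR : (s₁ s₂ : Str) (i : Fin (length s₂)) → splitPos s₁ s₂ (injR s₁ s₂ i) ≡ inj₂ i
  splitPos-injR []       s₂ i = refl
  splitPos-injR (a ∷ s₁) s₂ i rewrite splitPos-injR s₁ s₂ i = refl

  data SplitView (t₁ t₂ : Str) : Fin (length (t₁ ++ t₂)) → Set where
    left  : (j : Fin (length t₁)) → SplitView t₁ t₂ (injL t₁ t₂ j)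
    right : (j : Fin (length t₂)) → SplitView t₁ t₂ (injR t₁ t₂ j)

  splitView : (t₁ t₂ : Str) (j : Fin (length (t₁ ++ t₂))) → SplitView t₁ t₂ j
  splitView []       t₂ j       = right j
  splitView (a ∷ t₁) t₂ zero    = left zero
  splitView (a ∷ t₁) t₂ (suc j) with splitView t₁ t₂ j
  ... | left  j₁ = left (suc j₁)
  ... | right j₂ = right j₂

  -- Wiring of trace graphs

  module _ {s t} (G : Tragr s t) where

    -- Rule output ports are numbered in the reversed order of rhs, as by outPort.
    portOf : Out s (lab G) → Port (RNode G)
    portOf (inj₁ i)       = srcPort (toℕ i)
    portOf (inj₂ (v , o)) = rulePort v (length (rhs (lab G v)) ∸ suc (toℕ o))

    tgtFeed : Fin (length t) → Port (RNode G)
    tgtFeed j = portOf (wire G (inj₁ j))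

    ruleFeed : (v : RNode G) → Fin (length (lhs (lab G v))) → Port (RNode G)
    ruleFeed v i = portOf (wire G (inj₂ (v , i)))

    tgtWire : ℕ → Port (RNode G)
    tgtWire = lookupℕ t tgtFeed unwired

    ruleWire : RNode G → ℕ → Port (RNode G)
    ruleWire v = lookupℕ (lhs (lab G v)) (ruleFeed v) unwired

    -- In a graph composed after G, a wire from source position m continues the wire
    -- into target position m of G.
    resolve : ∀ {R} → Port R → Port (RNode G ⊎ R)
    resolve unwired        = unwired
    resolve (srcPort m)    = embedˡ (tgtWire m)
    resolve (rulePort v k) = rulePort (inj₂ v) k

  module _ {s₁ t₁ s₂ t₂} (G : Tragr s₁ t₁) (H : Tragr s₂ t₂) where
    private
      P : Tragr (s₁ ++ s₂) (t₁ ++ t₂)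
      P = par G H

    par-tgtFeedˡ : ∀ j → tgtFeed P (injL t₁ t₂ j) ≡ embedˡ (tgtFeed G j)
    par-tgtFeedˡ j rewrite splitPos-injL t₁ t₂ j with wire G (inj₁ j)
    ... | inj₁ i = cong srcPort (toℕ-injL s₁ s₂ i)
    ... | inj₂ _ = refl

    par-tgtFeedʳ : ∀ j → tgtFeed P (injR t₁ t₂ j) ≡ embedʳ (length s₁) (tgtFeed H j)
    par-tgtFeedʳ j rewrite splitPos-injR t₁ t₂ j with wire H (inj₁ j)
    ... | inj₁ i = cong srcPort (toℕ-injR s₁ s₂ i)
    ... | inj₂ _ = refl

    par-tgtWireˡ : (j : Fin (length t₁)) → tgtWire P (toℕ j) ≡ embedˡ (tgtWire G (toℕ j))
    par-tgtWireˡ j = begin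
      tgtWire P (toℕ j)
        ≡⟨ lookupℕ-injL t₁ t₂ (tgtFeed P) unwired j ⟩
      tgtFeed P (injL t₁ t₂ j)
        ≡⟨ par-tgtFeedˡ j ⟩
      embedˡ (tgtFeed G j)
        ≡⟨ cong embedˡ (lookupℕ-toℕ t₁ (tgtFeed G) unwired j) ⟨
      embedˡ (tgtWire G (toℕ j)) ∎

    par-tgtWireʳ : ∀ m → tgtWire P (length t₁ + m) ≡ embedʳ (length s₁) (tgtWire H m)
    par-tgtWireʳ m = begin
      tgtWire P (length t₁ + m)
        ≡⟨ lookupℕ-injR t₁ t₂ (tgtFeed P) unwired m ⟩
      lookupℕ t₂ (tgtFeed P ∘ injR t₁ t₂) unwired m
        ≡⟨ lookupℕ-natural t₂ (embedʳ _) unwired par-tgtFeedʳ m ⟩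
      embedʳ (length s₁) (tgtWire H m) ∎

    par-ruleWireˡ : ∀ v n → ruleWire P (inj₁ v) n ≡ embedˡ (ruleWire G v n)
    par-ruleWireˡ v = lookupℕ-natural (lhs (lab G v)) embedˡ unwired feed
      where
      feed : ∀ i → ruleFeed P (inj₁ v) i ≡ embedˡ (ruleFeed G v i)
      feed i with wire G (inj₂ (v , i))
      ... | inj₁ p = cong srcPort (toℕ-injL s₁ s₂ p)
      ... | inj₂ _ = refl

    par-ruleWireʳ : ∀ v n → ruleWire P (inj₂ v) n ≡ embedʳ (length s₁) (ruleWire H v n)
    par-ruleWireʳ v = lookupℕ-natural (lhs (lab H v)) (embedʳ _) unwired feed
      where
      feed : ∀ i → ruleFeed P (inj₂ v) i ≡ embedʳ (length s₁) (ruleFeed H v i)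
      feed i with wire H (inj₂ (v , i))
      ... | inj₁ p = cong srcPort (toℕ-injR s₁ s₂ p)
      ... | inj₂ _ = refl

  module _ {s t u} (G : Tragr s t) (H : Tragr t u) where
    private
      Q : Tragr s u
      Q = seq G H

    seq-tgtFeed : ∀ j → tgtFeed Q j ≡ resolve G (tgtFeed H j)
    seq-tgtFeed j with wire H (inj₁ j)
    ... | inj₂ _ = refl
    ... | inj₁ p rewrite lookupℕ-toℕ t (tgtFeed G) unwired p with wire G (inj₁ p)
    ...   | inj₁ _ = refl
    ...   | inj₂ _ = refl

    seq-tgtWire : ∀ n → tgtWire Q n ≡ resolve G (tgtWire H n)
    seq-tgtWire = lookupℕ-natural u (resolve G) unwired seq-tgtFeed

    seq-ruleWireˡ : ∀ v n → ruleWire Q (inj₁ v) n ≡ embedˡ (ruleWire G v n)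
    seq-ruleWireˡ v = lookupℕ-natural (lhs (lab G v)) embedˡ unwired feed
      where
      feed : ∀ i → ruleFeed Q (inj₁ v) i ≡ embedˡ (ruleFeed G v i)
      feed i with wire G (inj₂ (v , i))
      ... | inj₁ _ = refl
      ... | inj₂ _ = refl

    seq-ruleWireʳ : ∀ v n → ruleWire Q (inj₂ v) n ≡ resolve G (ruleWire H v n)
    seq-ruleWireʳ v = lookupℕ-natural (lhs (lab H v)) (resolve G) unwired feed
      where
      feed : ∀ i → ruleFeed Q (inj₂ v) i ≡ resolve G (ruleFeed H v i)
      feed i with wire H (inj₂ (v , i))
      ... | inj₂ _ = refl
      ... | inj₁ p rewrite lookupℕ-toℕ t (tgtFeed G) unwired p with wire G (inj₁ p)
      ...   | inj₁ _ = refl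
      ...   | inj₂ _ = refl

  -- Isomorphism of trace graphs

  record _≃ᵀ_ {s t s' t'} (G : Tragr s t) (H : Tragr s' t') : Set where
    field
      source≡ : s ≡ s'
      target≡ : t ≡ t'
      nodes   : RNode G ↔ RNode H
    open Inverse nodes public using (to; from; strictlyInverseˡ; strictlyInverseʳ)
    field
      lab-to      : ∀ v → lab H (to v) ≡ lab G v
      tgtWire-to  : ∀ n → tgtWire H n ≡ mapPort to (tgtWire G n)
      ruleWire-to : ∀ v n → ruleWire H (to v) n ≡ mapPort to (ruleWire G v n)

  open _≃ᵀ_

  ≃ᵀ-refl : ∀ {s t} (G : Tragr s t) → G ≃ᵀ G
  ≃ᵀ-refl G = record
    { source≡ = refl ; target≡ = refl ; nodes = ↔-refl
    ; lab-to = λ _ → refl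
    ; tgtWire-to = λ n → ≡.sym (mapPort-identity (λ _ → refl) (tgtWire G n))
    ; ruleWire-to = λ v n → ≡.sym (mapPort-identity (λ _ → refl) (ruleWire G v n)) }

  ≃ᵀ-sym : ∀ {s t s' t'} {G : Tragr s t} {H : Tragr s' t'} → G ≃ᵀ H → H ≃ᵀ G
  ≃ᵀ-sym {G = G} {H} I = record
    { source≡ = ≡.sym (source≡ I) ; target≡ = ≡.sym (target≡ I) ; nodes = ↔-sym (nodes I)
    ; lab-to = λ w → begin
        lab G (from I w)
          ≡⟨ lab-to I (from I w) ⟨
        lab H (to I (from I w))
          ≡⟨ cong (lab H) (strictlyInverseˡ I w) ⟩
        lab H w ∎
    ; tgtWire-to = λ n → begin
        tgtWire G n
          ≡⟨ mapPort-inverse (strictlyInverseʳ I) _ ⟨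
        mapPort (from I) (mapPort (to I) (tgtWire G n))
          ≡⟨ cong (mapPort (from I)) (tgtWire-to I n) ⟨
        mapPort (from I) (tgtWire H n) ∎
    ; ruleWire-to = λ w n → begin
        ruleWire G (from I w) n
          ≡⟨ mapPort-inverse (strictlyInverseʳ I) _ ⟨
        mapPort (from I) (mapPort (to I) (ruleWire G (from I w) n))
          ≡⟨ cong (mapPort (from I)) (ruleWire-to I (from I w) n) ⟨
        mapPort (from I) (ruleWire H (to I (from I w)) n)
          ≡⟨ cong (λ w′ → mapPort (from I) (ruleWire H w′ n)) (strictlyInverseˡ I w) ⟩
        mapPort (from I) (ruleWire H w n) ∎ }

  ≃ᵀ-trans : ∀ {s t s' t' s'' t''} {G : Tragr s t} {H : Tragr s' t'} {K : Tragr s'' t''} →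
             G ≃ᵀ H → H ≃ᵀ K → G ≃ᵀ K
  ≃ᵀ-trans {G = G} {H} {K} I J = record
    { source≡ = ≡.trans (source≡ I) (source≡ J) ; target≡ = ≡.trans (target≡ I) (target≡ J)
    ; nodes = ↔-trans (nodes I) (nodes J)
    ; lab-to = λ v → ≡.trans (lab-to J (to I v)) (lab-to I v)
    ; tgtWire-to = λ n → begin
        tgtWire K n
          ≡⟨ tgtWire-to J n ⟩
        mapPort (to J) (tgtWire H n)
          ≡⟨ cong (mapPort (to J)) (tgtWire-to I n) ⟩
        mapPort (to J) (mapPort (to I) (tgtWire G n))
          ≡⟨ mapPort-∘ (to J) (to I) _ ⟩
        mapPort (to J ∘ to I) (tgtWire G n) ∎
    ; ruleWire-to = λ v n → begin
        ruleWire K (to J (to I v)) n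
          ≡⟨ ruleWire-to J (to I v) n ⟩
        mapPort (to J) (ruleWire H (to I v) n)
          ≡⟨ cong (mapPort (to J)) (ruleWire-to I v n) ⟩
        mapPort (to J) (mapPort (to I) (ruleWire G v n))
          ≡⟨ mapPort-∘ (to J) (to I) _ ⟩
        mapPort (to J ∘ to I) (ruleWire G v n) ∎ }

  mapTNode : ∀ {s t R R'} → (R → R') → TNode s t R → TNode s t R'
  mapTNode f (src i)  = src i
  mapTNode f srcEnd   = srcEnd
  mapTNode f (node v) = node (f v)
  mapTNode f (tgt j)  = tgt j
  mapTNode f tgtEnd   = tgtEnd

  mapTNode-inverse : ∀ {s t R R'} {f : R → R'} {g : R' → R} → (∀ v → g (f v) ≡ v) →
                     (x : TNode s t R) → mapTNode g (mapTNode f x) ≡ x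
  mapTNode-inverse g∘f≗id (src i)  = refl
  mapTNode-inverse g∘f≗id srcEnd   = refl
  mapTNode-inverse g∘f≗id (node v) = cong node (g∘f≗id v)
  mapTNode-inverse g∘f≗id (tgt j)  = refl
  mapTNode-inverse g∘f≗id tgtEnd   = refl

  module _ {s t} {G H : Tragr s t} (I : G ≃ᵀ H) where

    onPort : TNode s t (RNode G) × ℕ → TNode s t (RNode H) × ℕ
    onPort (x , k) = mapTNode (to I) x , k

    tgtFeed-to : ∀ j → tgtFeed H j ≡ mapPort (to I) (tgtFeed G j)
    tgtFeed-to j = begin
      tgtFeed H j
        ≡⟨ lookupℕ-toℕ t (tgtFeed H) unwired j ⟨
      tgtWire H (toℕ j)
        ≡⟨ tgtWire-to I (toℕ j) ⟩
      mapPort (to I) (tgtWire G (toℕ j))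
        ≡⟨ cong (mapPort (to I)) (lookupℕ-toℕ t (tgtFeed G) unwired j) ⟩
      mapPort (to I) (tgtFeed G j) ∎

    ruleFeed-to : ∀ v i (i′ : Fin (length (lhs (lab H (to I v))))) → toℕ i′ ≡ toℕ i →
                  ruleFeed H (to I v) i′ ≡ mapPort (to I) (ruleFeed G v i)
    ruleFeed-to v i i′ i′≡i = begin
      ruleFeed H (to I v) i′
        ≡⟨ lookupℕ-toℕ (lhs (lab H (to I v))) (ruleFeed H (to I v)) unwired i′ ⟨
      ruleWire H (to I v) (toℕ i′)
        ≡⟨ cong (ruleWire H (to I v)) i′≡i ⟩
      ruleWire H (to I v) (toℕ i)
        ≡⟨ ruleWire-to I v (toℕ i) ⟩
      mapPort (to I) (ruleWire G v (toℕ i))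
        ≡⟨ cong (mapPort (to I)) (lookupℕ-toℕ (lhs (lab G v)) (ruleFeed G v) unwired i) ⟩
      mapPort (to I) (ruleFeed G v i) ∎

    outPort-to : ∀ y z → portOf H y ≡ mapPort (to I) (portOf G z) →
                 outPort H y ≡ onPort (outPort G z)
    outPort-to (inj₁ _) (inj₁ _) eq = cong (λ i → src i , 1) (toℕ-injective (srcPort-injective eq))
    outPort-to (inj₂ (w , _)) (inj₂ _) eq with rulePort-injective eq
    ... | refl , k≡k′ = cong (node w ,_) k≡k′

    edge-to : ∀ {p q} → TEdge G p q → TEdge H (onPort p) (onPort q)
    edge-to (srcStep i j eq)       = srcStep i j eq
    edge-to (srcLast i eq)         = srcLast i eq
    edge-to epsEdge                = epsEdge
    edge-to (tgtLast j eq)         = tgtLast j eq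
    edge-to (tgtStep i j eq)       = tgtStep i j eq
    edge-to (wireE (inj₁ j))       =
      subst₂ (TEdge H) (outPort-to (wire H (inj₁ j)) (wire G (inj₁ j)) (tgtFeed-to j)) refl
             (wireE (inj₁ j))
    edge-to (wireE (inj₂ (v , i))) =
      subst₂ (TEdge H) (outPort-to (wire H (inj₂ (to I v , i′))) (wire G (inj₂ (v , i)))
                                   (ruleFeed-to v i i′ (toℕ-cast _ i)))
                       (cong (λ k → node (to I v) , k) (toℕ-cast _ i))
             (wireE (inj₂ (to I v , i′)))
      where
      i′ : Fin (length (lhs (lab H (to I v))))
      i′ = cast (cong (length ∘ lhs) (≡.sym (lab-to I v))) i

  ≃ᵀ⇒≅ᴳ : ∀ {s t s' t'} {G : Tragr s t} {H : Tragr s' t'} → G ≃ᵀ H → toPG G ≅ᴳ toPG H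
  ≃ᵀ⇒≅ᴳ I with source≡ I | target≡ I
  ... | refl | refl = record
    { φ         = mk↔ₛ′ (mapTNode (to I)) (mapTNode (from I))
                        (mapTNode-inverse (strictlyInverseˡ I)) (mapTNode-inverse (strictlyInverseʳ I))
    ; kind-pres = kind-to
    ; edge-pres = λ x i y j → mk⇔ (edge-to I) (edge-from x i y j) }
    where
    kind-to : ∀ x → kindT _ (mapTNode (to I) x) ≡ kindT _ x
    kind-to (src i)  = refl
    kind-to srcEnd   = refl
    kind-to (node v) = cong ruleN (lab-to I v)
    kind-to (tgt j)  = refl
    kind-to tgtEnd   = refl
    edge-from : ∀ x i y j →
                TEdge _ (mapTNode (to I) x , i) (mapTNode (to I) y , j) → TEdge _ (x , i) (y , j)
    edge-from x i y j e =
      subst₂ (λ x′ y′ → TEdge _ (x′ , i) (y′ , j))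
             (mapTNode-inverse (strictlyInverseʳ I) x) (mapTNode-inverse (strictlyInverseʳ I) y)
             (edge-to (≃ᵀ-sym I) e)

  par-cong : ∀ {s₁ t₁ s₂ t₂ s₁' t₁' s₂' t₂'} {G : Tragr s₁ t₁} {G' : Tragr s₁' t₁'}
             {H : Tragr s₂ t₂} {H' : Tragr s₂' t₂'} → G ≃ᵀ G' → H ≃ᵀ H' → par G H ≃ᵀ par G' H'
  par-cong {s₁} {t₁} {G = G} {G'} {H} {H'} I J
    with source≡ I | target≡ I | source≡ J | target≡ J
  ... | refl | refl | refl | refl = record
    { source≡ = refl ; target≡ = refl ; nodes = ⊎-cong (nodes I) (nodes J)
    ; lab-to = [ lab-to I , lab-to J ]
    ; tgtWire-to = tgtWire-to′ ; ruleWire-to = [ ruleWire-toˡ , ruleWire-toʳ ] }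
    where
    F : RNode G ⊎ RNode H → RNode G' ⊎ RNode H'
    F = map (to I) (to J)
    tgtWire-to′ : ∀ n → tgtWire (par G' H') n ≡ mapPort F (tgtWire (par G H) n)
    tgtWire-to′ n with belowOrAbove (length t₁) n
    ... | below j = begin
      tgtWire (par G' H') (toℕ j)
        ≡⟨ par-tgtWireˡ G' H' j ⟩
      embedˡ (tgtWire G' (toℕ j))
        ≡⟨ cong embedˡ (tgtWire-to I (toℕ j)) ⟩
      embedˡ (mapPort (to I) (tgtWire G (toℕ j)))
        ≡⟨ mapPort-embedˡ (to I) (to J) _ ⟨
      mapPort F (embedˡ (tgtWire G (toℕ j)))
        ≡⟨ cong (mapPort F) (par-tgtWireˡ G H j) ⟨
      mapPort F (tgtWire (par G H) (toℕ j)) ∎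
    ... | above m = begin
      tgtWire (par G' H') (length t₁ + m)
        ≡⟨ par-tgtWireʳ G' H' m ⟩
      embedʳ (length s₁) (tgtWire H' m)
        ≡⟨ cong (embedʳ _) (tgtWire-to J m) ⟩
      embedʳ (length s₁) (mapPort (to J) (tgtWire H m))
        ≡⟨ mapPort-embedʳ (to I) (to J) _ _ ⟨
      mapPort F (embedʳ (length s₁) (tgtWire H m))
        ≡⟨ cong (mapPort F) (par-tgtWireʳ G H m) ⟨
      mapPort F (tgtWire (par G H) (length t₁ + m)) ∎
    ruleWire-toˡ : ∀ v n →
                   ruleWire (par G' H') (inj₁ (to I v)) n ≡ mapPort F (ruleWire (par G H) (inj₁ v) n)
    ruleWire-toˡ v n = begin
      ruleWire (par G' H') (inj₁ (to I v)) n
        ≡⟨ par-ruleWireˡ G' H' (to I v) n ⟩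
      embedˡ (ruleWire G' (to I v) n)
        ≡⟨ cong embedˡ (ruleWire-to I v n) ⟩
      embedˡ (mapPort (to I) (ruleWire G v n))
        ≡⟨ mapPort-embedˡ (to I) (to J) _ ⟨
      mapPort F (embedˡ (ruleWire G v n))
        ≡⟨ cong (mapPort F) (par-ruleWireˡ G H v n) ⟨
      mapPort F (ruleWire (par G H) (inj₁ v) n) ∎
    ruleWire-toʳ : ∀ v n →
                   ruleWire (par G' H') (inj₂ (to J v)) n ≡ mapPort F (ruleWire (par G H) (inj₂ v) n)
    ruleWire-toʳ v n = begin
      ruleWire (par G' H') (inj₂ (to J v)) n
        ≡⟨ par-ruleWireʳ G' H' (to J v) n ⟩
      embedʳ (length s₁) (ruleWire H' (to J v) n)
        ≡⟨ cong (embedʳ _) (ruleWire-to J v n) ⟩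
      embedʳ (length s₁) (mapPort (to J) (ruleWire H v n))
        ≡⟨ mapPort-embedʳ (to I) (to J) _ _ ⟨
      mapPort F (embedʳ (length s₁) (ruleWire H v n))
        ≡⟨ cong (mapPort F) (par-ruleWireʳ G H v n) ⟨
      mapPort F (ruleWire (par G H) (inj₂ v) n) ∎

  seq-cong : ∀ {s t u s' t' u'} {G : Tragr s t} {G' : Tragr s' t'}
             {H : Tragr t u} {H' : Tragr t' u'} → G ≃ᵀ G' → H ≃ᵀ H' → seq G H ≃ᵀ seq G' H'
  seq-cong {G = G} {G'} {H} {H'} I J with source≡ I | target≡ I | target≡ J
  ... | refl | refl | refl = record
    { source≡ = refl ; target≡ = refl ; nodes = ⊎-cong (nodes I) (nodes J)
    ; lab-to = [ lab-to I , lab-to J ]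
    ; tgtWire-to = tgtWire-to′ ; ruleWire-to = [ ruleWire-toˡ , ruleWire-toʳ ] }
    where
    F : RNode G ⊎ RNode H → RNode G' ⊎ RNode H'
    F = map (to I) (to J)
    resolve-to : ∀ p → resolve G' (mapPort (to J) p) ≡ mapPort F (resolve G p)
    resolve-to unwired        = refl
    resolve-to (rulePort v k) = refl
    resolve-to (srcPort m)    = begin
      embedˡ (tgtWire G' m)
        ≡⟨ cong embedˡ (tgtWire-to I m) ⟩
      embedˡ (mapPort (to I) (tgtWire G m))
        ≡⟨ mapPort-embedˡ (to I) (to J) _ ⟨
      mapPort F (embedˡ (tgtWire G m)) ∎
    tgtWire-to′ : ∀ n → tgtWire (seq G' H') n ≡ mapPort F (tgtWire (seq G H) n)
    tgtWire-to′ n = begin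
      tgtWire (seq G' H') n
        ≡⟨ seq-tgtWire G' H' n ⟩
      resolve G' (tgtWire H' n)
        ≡⟨ cong (resolve G') (tgtWire-to J n) ⟩
      resolve G' (mapPort (to J) (tgtWire H n))
        ≡⟨ resolve-to (tgtWire H n) ⟩
      mapPort F (resolve G (tgtWire H n))
        ≡⟨ cong (mapPort F) (seq-tgtWire G H n) ⟨
      mapPort F (tgtWire (seq G H) n) ∎
    ruleWire-toˡ : ∀ v n →
                   ruleWire (seq G' H') (inj₁ (to I v)) n ≡ mapPort F (ruleWire (seq G H) (inj₁ v) n)
    ruleWire-toˡ v n = begin
      ruleWire (seq G' H') (inj₁ (to I v)) n
        ≡⟨ seq-ruleWireˡ G' H' (to I v) n ⟩
      embedˡ (ruleWire G' (to I v) n)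
        ≡⟨ cong embedˡ (ruleWire-to I v n) ⟩
      embedˡ (mapPort (to I) (ruleWire G v n))
        ≡⟨ mapPort-embedˡ (to I) (to J) _ ⟨
      mapPort F (embedˡ (ruleWire G v n))
        ≡⟨ cong (mapPort F) (seq-ruleWireˡ G H v n) ⟨
      mapPort F (ruleWire (seq G H) (inj₁ v) n) ∎
    ruleWire-toʳ : ∀ v n →
                   ruleWire (seq G' H') (inj₂ (to J v)) n ≡ mapPort F (ruleWire (seq G H) (inj₂ v) n)
    ruleWire-toʳ v n = begin
      ruleWire (seq G' H') (inj₂ (to J v)) n
        ≡⟨ seq-ruleWireʳ G' H' (to J v) n ⟩
      resolve G' (ruleWire H' (to J v) n)
        ≡⟨ cong (resolve G') (ruleWire-to J v n) ⟩
      resolve G' (mapPort (to J) (ruleWire H v n))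
        ≡⟨ resolve-to (ruleWire H v n) ⟩
      mapPort F (resolve G (ruleWire H v n))
        ≡⟨ cong (mapPort F) (seq-ruleWireʳ G H v n) ⟨
      mapPort F (ruleWire (seq G H) (inj₂ v) n) ∎

  -- The generating equations

  module _ {s t} (G : Tragr s t) where

    par-identityˡ : par ⟦ ε∶ ⟧ G ≃ᵀ G
    par-identityˡ = record
      { source≡ = refl ; target≡ = refl ; nodes = ⊎-identityˡ-empty λ ()
      ; lab-to = [ (λ ()) , (λ _ → refl) ]
      ; tgtWire-to = λ n →
          ≡.trans (unshift _) (cong (mapPort F) (≡.sym (par-tgtWireʳ ⟦ ε∶ ⟧ G n)))
      ; ruleWire-to = [ (λ ()) , (λ v n →
          ≡.trans (unshift _) (cong (mapPort F) (≡.sym (par-ruleWireʳ ⟦ ε∶ ⟧ G v n)))) ] }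
      where
      F : ⊥ ⊎ RNode G → RNode G
      F = Inverse.to (⊎-identityˡ-empty λ ())
      unshift : ∀ p → p ≡ mapPort F (embedʳ 0 p)
      unshift unwired        = refl
      unshift (srcPort m)    = refl
      unshift (rulePort v k) = refl

    par-identityʳ : par G ⟦ ε∶ ⟧ ≃ᵀ G
    par-identityʳ = record
      { source≡ = ++-identityʳ s ; target≡ = ++-identityʳ t ; nodes = ⊎-identityʳ-empty λ ()
      ; lab-to = [ (λ _ → refl) , (λ ()) ]
      ; tgtWire-to = tgtWire-to′
      ; ruleWire-to = [ (λ v n →
          ≡.trans (unembed _) (cong (mapPort F) (≡.sym (par-ruleWireˡ G ⟦ ε∶ ⟧ v n))))
                      , (λ ()) ] }
      where
      F : RNode G ⊎ ⊥ → RNode G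
      F = Inverse.to (⊎-identityʳ-empty λ ())
      unembed : ∀ p → p ≡ mapPort F (embedˡ p)
      unembed p = ≡.sym (mapPort-inverse (λ _ → refl) p)
      tgtWire-to′ : ∀ n → tgtWire G n ≡ mapPort F (tgtWire (par G ⟦ ε∶ ⟧) n)
      tgtWire-to′ n with belowOrAbove (length t) n
      ... | below j = ≡.trans (unembed _) (cong (mapPort F) (≡.sym (par-tgtWireˡ G ⟦ ε∶ ⟧ j)))
      ... | above m = ≡.trans (lookupℕ-beyond t (tgtFeed G) unwired m)
                              (cong (mapPort F) (≡.sym (par-tgtWireʳ G ⟦ ε∶ ⟧ m)))

  module _ {s₁ t₁ s₂ t₂ s₃ t₃} (G₁ : Tragr s₁ t₁) (G₂ : Tragr s₂ t₂) (G₃ : Tragr s₃ t₃) where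
    private
      G₁₂ : Tragr (s₁ ++ s₂) (t₁ ++ t₂)
      G₁₂ = par G₁ G₂
      G₂₃ : Tragr (s₂ ++ s₃) (t₂ ++ t₃)
      G₂₃ = par G₂ G₃
      L : Tragr ((s₁ ++ s₂) ++ s₃) ((t₁ ++ t₂) ++ t₃)
      L = par G₁₂ G₃
      R : Tragr (s₁ ++ (s₂ ++ s₃)) (t₁ ++ (t₂ ++ t₃))
      R = par G₁ G₂₃

      F : RNode L → RNode R
      F = assocʳ

      assoc-embedʳˡ : (p : Port (RNode G₂)) →
                      embedʳ (length s₁) (embedˡ p) ≡ mapPort F (embedˡ (embedʳ (length s₁) p))
      assoc-embedʳˡ unwired        = refl
      assoc-embedʳˡ (srcPort m)    = refl
      assoc-embedʳˡ (rulePort v k) = refl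

      assoc-embedʳʳ : (p : Port (RNode G₃)) → embedʳ (length s₁) (embedʳ (length s₂) p)
                                             ≡ mapPort F (embedʳ (length (s₁ ++ s₂)) p)
      assoc-embedʳʳ unwired        = refl
      assoc-embedʳʳ (srcPort m)    = cong srcPort (begin
        length s₁ + (length s₂ + m)
          ≡⟨ +-assoc (length s₁) (length s₂) m ⟨
        length s₁ + length s₂ + m
          ≡⟨ cong (_+ m) (length-++ s₁) ⟨
        length (s₁ ++ s₂) + m ∎)
      assoc-embedʳʳ (rulePort v k) = refl

    par-assoc-tgtWire : ∀ n → tgtWire R n ≡ mapPort F (tgtWire L n)
    par-assoc-tgtWire n with belowOrAbove (length t₁) n
    ... | below j = begin
      tgtWire R (toℕ j)
        ≡⟨ par-tgtWireˡ G₁ G₂₃ j ⟩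
      embedˡ (tgtWire G₁ (toℕ j))
        ≡⟨ mapPort-assocʳ-embedˡ² _ ⟨
      mapPort F (embedˡ (embedˡ (tgtWire G₁ (toℕ j))))
        ≡⟨ cong (mapPort F ∘ embedˡ) (par-tgtWireˡ G₁ G₂ j) ⟨
      mapPort F (embedˡ (tgtWire G₁₂ (toℕ j)))
        ≡⟨ cong (mapPort F ∘ embedˡ ∘ tgtWire G₁₂) (toℕ-injL t₁ t₂ j) ⟨
      mapPort F (embedˡ (tgtWire G₁₂ (toℕ (injL t₁ t₂ j))))
        ≡⟨ cong (mapPort F) (par-tgtWireˡ G₁₂ G₃ (injL t₁ t₂ j)) ⟨
      mapPort F (tgtWire L (toℕ (injL t₁ t₂ j)))
        ≡⟨ cong (mapPort F ∘ tgtWire L) (toℕ-injL t₁ t₂ j) ⟩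
      mapPort F (tgtWire L (toℕ j)) ∎
    ... | above m with belowOrAbove (length t₂) m
    ...   | below j = begin
      tgtWire R (length t₁ + toℕ j)
        ≡⟨ par-tgtWireʳ G₁ G₂₃ (toℕ j) ⟩
      embedʳ (length s₁) (tgtWire G₂₃ (toℕ j))
        ≡⟨ cong (embedʳ _) (par-tgtWireˡ G₂ G₃ j) ⟩
      embedʳ (length s₁) (embedˡ (tgtWire G₂ (toℕ j)))
        ≡⟨ assoc-embedʳˡ _ ⟩
      mapPort F (embedˡ (embedʳ (length s₁) (tgtWire G₂ (toℕ j))))
        ≡⟨ cong (mapPort F ∘ embedˡ) (par-tgtWireʳ G₁ G₂ (toℕ j)) ⟨
      mapPort F (embedˡ (tgtWire G₁₂ (length t₁ + toℕ j)))
        ≡⟨ cong (mapPort F ∘ embedˡ ∘ tgtWire G₁₂) (toℕ-injR t₁ t₂ j) ⟨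
      mapPort F (embedˡ (tgtWire G₁₂ (toℕ (injR t₁ t₂ j))))
        ≡⟨ cong (mapPort F) (par-tgtWireˡ G₁₂ G₃ (injR t₁ t₂ j)) ⟨
      mapPort F (tgtWire L (toℕ (injR t₁ t₂ j)))
        ≡⟨ cong (mapPort F ∘ tgtWire L) (toℕ-injR t₁ t₂ j) ⟩
      mapPort F (tgtWire L (length t₁ + toℕ j)) ∎
    ...   | above m′ = begin
      tgtWire R (length t₁ + (length t₂ + m′))
        ≡⟨ par-tgtWireʳ G₁ G₂₃ (length t₂ + m′) ⟩
      embedʳ (length s₁) (tgtWire G₂₃ (length t₂ + m′))
        ≡⟨ cong (embedʳ _) (par-tgtWireʳ G₂ G₃ m′) ⟩
      embedʳ (length s₁) (embedʳ (length s₂) (tgtWire G₃ m′))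
        ≡⟨ assoc-embedʳʳ _ ⟩
      mapPort F (embedʳ (length (s₁ ++ s₂)) (tgtWire G₃ m′))
        ≡⟨ cong (mapPort F) (par-tgtWireʳ G₁₂ G₃ m′) ⟨
      mapPort F (tgtWire L (length (t₁ ++ t₂) + m′))
        ≡⟨ cong (mapPort F ∘ tgtWire L) t₁₂-offset ⟩
      mapPort F (tgtWire L (length t₁ + (length t₂ + m′))) ∎
      where
      t₁₂-offset : length (t₁ ++ t₂) + m′ ≡ length t₁ + (length t₂ + m′)
      t₁₂-offset = ≡.trans (cong (_+ m′) (length-++ t₁)) (+-assoc (length t₁) (length t₂) m′)

    par-assoc-ruleWire : ∀ v n → ruleWire R (F v) n ≡ mapPort F (ruleWire L v n)
    par-assoc-ruleWire (inj₁ (inj₁ v)) n = begin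
      ruleWire R (inj₁ v) n
        ≡⟨ par-ruleWireˡ G₁ G₂₃ v n ⟩
      embedˡ (ruleWire G₁ v n)
        ≡⟨ mapPort-assocʳ-embedˡ² _ ⟨
      mapPort F (embedˡ (embedˡ (ruleWire G₁ v n)))
        ≡⟨ cong (mapPort F ∘ embedˡ) (par-ruleWireˡ G₁ G₂ v n) ⟨
      mapPort F (embedˡ (ruleWire G₁₂ (inj₁ v) n))
        ≡⟨ cong (mapPort F) (par-ruleWireˡ G₁₂ G₃ (inj₁ v) n) ⟨
      mapPort F (ruleWire L (inj₁ (inj₁ v)) n) ∎
    par-assoc-ruleWire (inj₁ (inj₂ v)) n = begin
      ruleWire R (inj₂ (inj₁ v)) n
        ≡⟨ par-ruleWireʳ G₁ G₂₃ (inj₁ v) n ⟩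
      embedʳ (length s₁) (ruleWire G₂₃ (inj₁ v) n)
        ≡⟨ cong (embedʳ _) (par-ruleWireˡ G₂ G₃ v n) ⟩
      embedʳ (length s₁) (embedˡ (ruleWire G₂ v n))
        ≡⟨ assoc-embedʳˡ _ ⟩
      mapPort F (embedˡ (embedʳ (length s₁) (ruleWire G₂ v n)))
        ≡⟨ cong (mapPort F ∘ embedˡ) (par-ruleWireʳ G₁ G₂ v n) ⟨
      mapPort F (embedˡ (ruleWire G₁₂ (inj₂ v) n))
        ≡⟨ cong (mapPort F) (par-ruleWireˡ G₁₂ G₃ (inj₂ v) n) ⟨
      mapPort F (ruleWire L (inj₁ (inj₂ v)) n) ∎
    par-assoc-ruleWire (inj₂ v) n = begin
      ruleWire R (inj₂ (inj₂ v)) n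
        ≡⟨ par-ruleWireʳ G₁ G₂₃ (inj₂ v) n ⟩
      embedʳ (length s₁) (ruleWire G₂₃ (inj₂ v) n)
        ≡⟨ cong (embedʳ _) (par-ruleWireʳ G₂ G₃ v n) ⟩
      embedʳ (length s₁) (embedʳ (length s₂) (ruleWire G₃ v n))
        ≡⟨ assoc-embedʳʳ _ ⟩
      mapPort F (embedʳ (length (s₁ ++ s₂)) (ruleWire G₃ v n))
        ≡⟨ cong (mapPort F) (par-ruleWireʳ G₁₂ G₃ v n) ⟨
      mapPort F (ruleWire L (inj₂ v) n) ∎

    par-assoc : par (par G₁ G₂) G₃ ≃ᵀ par G₁ (par G₂ G₃)
    par-assoc = record
      { source≡ = ++-assoc s₁ s₂ s₃ ; target≡ = ++-assoc t₁ t₂ t₃ ; nodes = ⊎-assoc 0ℓ _ _ _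
      ; lab-to = [ [ (λ _ → refl) , (λ _ → refl) ] , (λ _ → refl) ]
      ; tgtWire-to = par-assoc-tgtWire ; ruleWire-to = par-assoc-ruleWire }

  record IsIdentity {s t} (G : Tragr s t) : Set where
    field
      source≡target : s ≡ t
      no-nodes      : ¬ RNode G
      tgtFeed-src   : ∀ j → tgtFeed G j ≡ srcPort (toℕ j)

  open IsIdentity

  module _ {s t} {Σ′ : Tragr s t} (I : IsIdentity Σ′) where

    seq-identityˡ : ∀ {u} (G : Tragr t u) → seq Σ′ G ≃ᵀ G
    seq-identityˡ {u} G = record
      { source≡ = source≡target I ; target≡ = refl ; nodes = ⊎-identityˡ-empty (no-nodes I)
      ; lab-to = [ (λ v → ⊥-elim (no-nodes I v)) , (λ _ → refl) ]
      ; tgtWire-to = λ n → begin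
          tgtWire G n
            ≡⟨ lookupℕ-natural u viaΣ′ unwired (unresolve ∘ wire G ∘ inj₁) n ⟩
          mapPort F (resolve Σ′ (tgtWire G n))
            ≡⟨ cong (mapPort F) (seq-tgtWire Σ′ G n) ⟨
          mapPort F (tgtWire (seq Σ′ G) n) ∎
      ; ruleWire-to = [ (λ v → ⊥-elim (no-nodes I v)) , (λ v n → begin
          ruleWire G v n
            ≡⟨ lookupℕ-natural (lhs (lab G v)) viaΣ′ unwired
                               (λ i → unresolve (wire G (inj₂ (v , i)))) n ⟩
          mapPort F (resolve Σ′ (ruleWire G v n))
            ≡⟨ cong (mapPort F) (seq-ruleWireʳ Σ′ G v n) ⟨
          mapPort F (ruleWire (seq Σ′ G) (inj₂ v) n) ∎) ] }
      where
      F : RNode Σ′ ⊎ RNode G → RNode G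
      F = Inverse.to (⊎-identityˡ-empty (no-nodes I))
      viaΣ′ : Port (RNode G) → Port (RNode G)
      viaΣ′ = mapPort F ∘ resolve Σ′
      unresolve : ∀ o → portOf G o ≡ viaΣ′ (portOf G o)
      unresolve (inj₂ _) = refl
      unresolve (inj₁ i) = begin
        mapPort F (embedˡ (srcPort (toℕ i)))
          ≡⟨ cong (mapPort F ∘ embedˡ) (tgtFeed-src I i) ⟨
        mapPort F (embedˡ (tgtFeed Σ′ i))
          ≡⟨ cong (mapPort F ∘ embedˡ) (lookupℕ-toℕ t (tgtFeed Σ′) unwired i) ⟨
        mapPort F (embedˡ (tgtWire Σ′ (toℕ i))) ∎

    seq-identityʳ : ∀ {r} (G : Tragr r s) → seq G Σ′ ≃ᵀ G
    seq-identityʳ G with source≡target I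
    ... | refl = record
      { source≡ = refl ; target≡ = refl ; nodes = ⊎-identityʳ-empty (no-nodes I)
      ; lab-to = [ (λ _ → refl) , (λ v → ⊥-elim (no-nodes I v)) ]
      ; tgtWire-to = tgtWire-to′
      ; ruleWire-to = [ (λ v n → begin
          ruleWire G v n
            ≡⟨ mapPort-inverse (λ _ → refl) _ ⟨
          mapPort F (embedˡ (ruleWire G v n))
            ≡⟨ cong (mapPort F) (seq-ruleWireˡ G Σ′ v n) ⟨
          mapPort F (ruleWire (seq G Σ′) (inj₁ v) n) ∎) , (λ v → ⊥-elim (no-nodes I v)) ] }
      where
      F : RNode G ⊎ RNode Σ′ → RNode G
      F = Inverse.to (⊎-identityʳ-empty (no-nodes I))
      tgtWire-to′ : ∀ n → tgtWire G n ≡ mapPort F (tgtWire (seq G Σ′) n)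
      tgtWire-to′ n with belowOrAbove (length s) n
      ... | below j = begin
        tgtWire G (toℕ j)
          ≡⟨ mapPort-inverse (λ _ → refl) _ ⟨
        mapPort F (resolve G (srcPort (toℕ j)))
          ≡⟨ cong (mapPort F ∘ resolve G) (tgtFeed-src I j) ⟨
        mapPort F (resolve G (tgtFeed Σ′ j))
          ≡⟨ cong (mapPort F ∘ resolve G) (lookupℕ-toℕ s (tgtFeed Σ′) unwired j) ⟨
        mapPort F (resolve G (tgtWire Σ′ (toℕ j)))
          ≡⟨ cong (mapPort F) (seq-tgtWire G Σ′ (toℕ j)) ⟨
        mapPort F (tgtWire (seq G Σ′) (toℕ j)) ∎
      ... | above m = begin
        tgtWire G (length s + m)
          ≡⟨ lookupℕ-beyond s (tgtFeed G) unwired m ⟩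
        mapPort F (resolve G unwired)
          ≡⟨ cong (mapPort F ∘ resolve G) (lookupℕ-beyond s (tgtFeed Σ′) unwired m) ⟨
        mapPort F (resolve G (tgtWire Σ′ (length s + m)))
          ≡⟨ cong (mapPort F) (seq-tgtWire G Σ′ (length s + m)) ⟨
        mapPort F (tgtWire (seq G Σ′) (length s + m)) ∎

  string⇒identity : ∀ {σ s t} → IsString σ → (d : σ ∶ s ⇒ t) → IsIdentity ⟦ d ⟧
  string⇒identity ε       ε∶       =
    record { source≡target = refl ; no-nodes = λ () ; tgtFeed-src = λ () }
  string⇒identity (ltr a) (ltr∶ a) =
    record { source≡target = refl ; no-nodes = λ () ; tgtFeed-src = λ { zero → refl } }
  string⇒identity (σ₁ ⊗ σ₂) (⊗∶ {s₁ = s₁} {t₁} {s₂} {t₂} d₁ d₂) = record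
    { source≡target = cong₂ _++_ (source≡target I₁) (source≡target I₂)
    ; no-nodes = [ no-nodes I₁ , no-nodes I₂ ]
    ; tgtFeed-src = feed }
    where
    I₁ : IsIdentity ⟦ d₁ ⟧
    I₁ = string⇒identity σ₁ d₁
    I₂ : IsIdentity ⟦ d₂ ⟧
    I₂ = string⇒identity σ₂ d₂
    feed : ∀ j → tgtFeed (par ⟦ d₁ ⟧ ⟦ d₂ ⟧) j ≡ srcPort (toℕ j)
    feed j with splitView t₁ t₂ j
    ... | left j₁ = begin
      tgtFeed (par ⟦ d₁ ⟧ ⟦ d₂ ⟧) (injL t₁ t₂ j₁)
        ≡⟨ par-tgtFeedˡ ⟦ d₁ ⟧ ⟦ d₂ ⟧ j₁ ⟩
      embedˡ (tgtFeed ⟦ d₁ ⟧ j₁)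
        ≡⟨ cong embedˡ (tgtFeed-src I₁ j₁) ⟩
      srcPort (toℕ j₁)
        ≡⟨ cong srcPort (toℕ-injL t₁ t₂ j₁) ⟨
      srcPort (toℕ (injL t₁ t₂ j₁)) ∎
    ... | right j₂ = begin
      tgtFeed (par ⟦ d₁ ⟧ ⟦ d₂ ⟧) (injR t₁ t₂ j₂)
        ≡⟨ par-tgtFeedʳ ⟦ d₁ ⟧ ⟦ d₂ ⟧ j₂ ⟩
      embedʳ (length s₁) (tgtFeed ⟦ d₂ ⟧ j₂)
        ≡⟨ cong (embedʳ _) (tgtFeed-src I₂ j₂) ⟩
      srcPort (length s₁ + toℕ j₂)
        ≡⟨ cong (λ r → srcPort (length r + toℕ j₂)) (source≡target I₁) ⟩
      srcPort (length t₁ + toℕ j₂)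
        ≡⟨ cong srcPort (toℕ-injR t₁ t₂ j₂) ⟨
      srcPort (toℕ (injR t₁ t₂ j₂)) ∎

  module _ {s t u w} (G₁ : Tragr s t) (G₂ : Tragr t u) (G₃ : Tragr u w) where
    private
      G₁₂ : Tragr s u
      G₁₂ = seq G₁ G₂
      G₂₃ : Tragr t w
      G₂₃ = seq G₂ G₃
      L R : Tragr s w
      L = seq G₁₂ G₃
      R = seq G₁ G₂₃

      F : RNode L → RNode R
      F = assocʳ

      resolve-embedˡ : (p : Port (RNode G₂)) →
                       resolve G₁ (embedˡ p) ≡ mapPort F (embedˡ (resolve G₁ p))
      resolve-embedˡ unwired        = refl
      resolve-embedˡ (srcPort m)    = ≡.sym (mapPort-assocʳ-embedˡ² _)
      resolve-embedˡ (rulePort v k) = refl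

      resolve-resolve : (p : Port (RNode G₃)) →
                        resolve G₁ (resolve G₂ p) ≡ mapPort F (resolve G₁₂ p)
      resolve-resolve unwired        = refl
      resolve-resolve (srcPort m)    = begin
        resolve G₁ (embedˡ (tgtWire G₂ m))
          ≡⟨ resolve-embedˡ (tgtWire G₂ m) ⟩
        mapPort F (embedˡ (resolve G₁ (tgtWire G₂ m)))
          ≡⟨ cong (mapPort F ∘ embedˡ) (seq-tgtWire G₁ G₂ m) ⟨
        mapPort F (embedˡ (tgtWire G₁₂ m)) ∎
      resolve-resolve (rulePort v k) = refl

    seq-assoc-ruleWire : ∀ v n → ruleWire R (F v) n ≡ mapPort F (ruleWire L v n)
    seq-assoc-ruleWire (inj₁ (inj₁ v)) n = begin
      ruleWire R (inj₁ v) n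
        ≡⟨ seq-ruleWireˡ G₁ G₂₃ v n ⟩
      embedˡ (ruleWire G₁ v n)
        ≡⟨ mapPort-assocʳ-embedˡ² _ ⟨
      mapPort F (embedˡ (embedˡ (ruleWire G₁ v n)))
        ≡⟨ cong (mapPort F ∘ embedˡ) (seq-ruleWireˡ G₁ G₂ v n) ⟨
      mapPort F (embedˡ (ruleWire G₁₂ (inj₁ v) n))
        ≡⟨ cong (mapPort F) (seq-ruleWireˡ G₁₂ G₃ (inj₁ v) n) ⟨
      mapPort F (ruleWire L (inj₁ (inj₁ v)) n) ∎
    seq-assoc-ruleWire (inj₁ (inj₂ v)) n = begin
      ruleWire R (inj₂ (inj₁ v)) n
        ≡⟨ seq-ruleWireʳ G₁ G₂₃ (inj₁ v) n ⟩
      resolve G₁ (ruleWire G₂₃ (inj₁ v) n)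
        ≡⟨ cong (resolve G₁) (seq-ruleWireˡ G₂ G₃ v n) ⟩
      resolve G₁ (embedˡ (ruleWire G₂ v n))
        ≡⟨ resolve-embedˡ (ruleWire G₂ v n) ⟩
      mapPort F (embedˡ (resolve G₁ (ruleWire G₂ v n)))
        ≡⟨ cong (mapPort F ∘ embedˡ) (seq-ruleWireʳ G₁ G₂ v n) ⟨
      mapPort F (embedˡ (ruleWire G₁₂ (inj₂ v) n))
        ≡⟨ cong (mapPort F) (seq-ruleWireˡ G₁₂ G₃ (inj₂ v) n) ⟨
      mapPort F (ruleWire L (inj₁ (inj₂ v)) n) ∎
    seq-assoc-ruleWire (inj₂ v) n = begin
      ruleWire R (inj₂ (inj₂ v)) n
        ≡⟨ seq-ruleWireʳ G₁ G₂₃ (inj₂ v) n ⟩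
      resolve G₁ (ruleWire G₂₃ (inj₂ v) n)
        ≡⟨ cong (resolve G₁) (seq-ruleWireʳ G₂ G₃ v n) ⟩
      resolve G₁ (resolve G₂ (ruleWire G₃ v n))
        ≡⟨ resolve-resolve (ruleWire G₃ v n) ⟩
      mapPort F (resolve G₁₂ (ruleWire G₃ v n))
        ≡⟨ cong (mapPort F) (seq-ruleWireʳ G₁₂ G₃ v n) ⟨
      mapPort F (ruleWire L (inj₂ v) n) ∎

    seq-assoc : seq (seq G₁ G₂) G₃ ≃ᵀ seq G₁ (seq G₂ G₃)
    seq-assoc = record
      { source≡ = refl ; target≡ = refl ; nodes = ⊎-assoc 0ℓ _ _ _
      ; lab-to = [ [ (λ _ → refl) , (λ _ → refl) ] , (λ _ → refl) ]
      ; tgtWire-to = λ n → begin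
          tgtWire R n
            ≡⟨ seq-tgtWire G₁ G₂₃ n ⟩
          resolve G₁ (tgtWire G₂₃ n)
            ≡⟨ cong (resolve G₁) (seq-tgtWire G₂ G₃ n) ⟩
          resolve G₁ (resolve G₂ (tgtWire G₃ n))
            ≡⟨ resolve-resolve (tgtWire G₃ n) ⟩
          mapPort F (resolve G₁₂ (tgtWire G₃ n))
            ≡⟨ cong (mapPort F) (seq-tgtWire G₁₂ G₃ n) ⟨
          mapPort F (tgtWire L n) ∎
      ; ruleWire-to = seq-assoc-ruleWire }

  module _ {s₁ t₁ u₁ s₂ t₂ u₂} (G₁ : Tragr s₁ t₁) (G₂ : Tragr s₂ t₂)
           (H₁ : Tragr t₁ u₁) (H₂ : Tragr t₂ u₂) where
    private
      G : Tragr (s₁ ++ s₂) (t₁ ++ t₂)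
      G = par G₁ G₂
      H : Tragr (t₁ ++ t₂) (u₁ ++ u₂)
      H = par H₁ H₂
      L R : Tragr (s₁ ++ s₂) (u₁ ++ u₂)
      L = seq G H
      R = par (seq G₁ H₁) (seq G₂ H₂)

      F : RNode L → RNode R
      F = Inverse.to ⊎-interchange

      embedˡˡ : (p : Port (RNode G₁)) → embedˡ (embedˡ p) ≡ mapPort F (embedˡ (embedˡ p))
      embedˡˡ unwired        = refl
      embedˡˡ (srcPort m)    = refl
      embedˡˡ (rulePort v k) = refl

      embedʳˡ : (p : Port (RNode G₂)) →
                embedʳ (length s₁) (embedˡ p) ≡ mapPort F (embedˡ (embedʳ (length s₁) p))
      embedʳˡ unwired        = refl
      embedʳˡ (srcPort m)    = refl
      embedʳˡ (rulePort v k) = refl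

      resolveˡ : (o : Out t₁ (lab H₁)) →
                 embedˡ (resolve G₁ (portOf H₁ o)) ≡ mapPort F (resolve G (embedˡ (portOf H₁ o)))
      resolveˡ (inj₂ _) = refl
      resolveˡ (inj₁ i) = begin
        embedˡ (embedˡ (tgtWire G₁ (toℕ i)))
          ≡⟨ embedˡˡ _ ⟩
        mapPort F (embedˡ (embedˡ (tgtWire G₁ (toℕ i))))
          ≡⟨ cong (mapPort F ∘ embedˡ) (par-tgtWireˡ G₁ G₂ i) ⟨
        mapPort F (embedˡ (tgtWire G (toℕ i))) ∎

      resolveʳ : (p : Port (RNode H₂)) →
                 embedʳ (length s₁) (resolve G₂ p) ≡ mapPort F (resolve G (embedʳ (length t₁) p))
      resolveʳ unwired        = refl
      resolveʳ (rulePort v k) = refl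
      resolveʳ (srcPort m)    = begin
        embedʳ (length s₁) (embedˡ (tgtWire G₂ m))
          ≡⟨ embedʳˡ _ ⟩
        mapPort F (embedˡ (embedʳ (length s₁) (tgtWire G₂ m)))
          ≡⟨ cong (mapPort F ∘ embedˡ) (par-tgtWireʳ G₁ G₂ m) ⟨
        mapPort F (embedˡ (tgtWire G (length t₁ + m))) ∎

    interchange-tgtWire : ∀ n → tgtWire R n ≡ mapPort F (tgtWire L n)
    interchange-tgtWire n with belowOrAbove (length u₁) n
    ... | below j = begin
      tgtWire R (toℕ j)
        ≡⟨ par-tgtWireˡ (seq G₁ H₁) (seq G₂ H₂) j ⟩
      embedˡ (tgtWire (seq G₁ H₁) (toℕ j))
        ≡⟨ cong embedˡ (seq-tgtWire G₁ H₁ (toℕ j)) ⟩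
      embedˡ (resolve G₁ (tgtWire H₁ (toℕ j)))
        ≡⟨ cong (embedˡ ∘ resolve G₁) (lookupℕ-toℕ u₁ (tgtFeed H₁) unwired j) ⟩
      embedˡ (resolve G₁ (tgtFeed H₁ j))
        ≡⟨ resolveˡ (wire H₁ (inj₁ j)) ⟩
      mapPort F (resolve G (embedˡ (tgtFeed H₁ j)))
        ≡⟨ cong (mapPort F ∘ resolve G ∘ embedˡ) (lookupℕ-toℕ u₁ (tgtFeed H₁) unwired j) ⟨
      mapPort F (resolve G (embedˡ (tgtWire H₁ (toℕ j))))
        ≡⟨ cong (mapPort F ∘ resolve G) (par-tgtWireˡ H₁ H₂ j) ⟨
      mapPort F (resolve G (tgtWire H (toℕ j)))
        ≡⟨ cong (mapPort F) (seq-tgtWire G H (toℕ j)) ⟨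
      mapPort F (tgtWire L (toℕ j)) ∎
    ... | above m = begin
      tgtWire R (length u₁ + m)
        ≡⟨ par-tgtWireʳ (seq G₁ H₁) (seq G₂ H₂) m ⟩
      embedʳ (length s₁) (tgtWire (seq G₂ H₂) m)
        ≡⟨ cong (embedʳ _) (seq-tgtWire G₂ H₂ m) ⟩
      embedʳ (length s₁) (resolve G₂ (tgtWire H₂ m))
        ≡⟨ resolveʳ (tgtWire H₂ m) ⟩
      mapPort F (resolve G (embedʳ (length t₁) (tgtWire H₂ m)))
        ≡⟨ cong (mapPort F ∘ resolve G) (par-tgtWireʳ H₁ H₂ m) ⟨
      mapPort F (resolve G (tgtWire H (length u₁ + m)))
        ≡⟨ cong (mapPort F) (seq-tgtWire G H (length u₁ + m)) ⟨
      mapPort F (tgtWire L (length u₁ + m)) ∎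

    interchange-ruleWire : ∀ v n → ruleWire R (F v) n ≡ mapPort F (ruleWire L v n)
    interchange-ruleWire (inj₁ (inj₁ v)) n = begin
      ruleWire R (inj₁ (inj₁ v)) n
        ≡⟨ par-ruleWireˡ (seq G₁ H₁) (seq G₂ H₂) (inj₁ v) n ⟩
      embedˡ (ruleWire (seq G₁ H₁) (inj₁ v) n)
        ≡⟨ cong embedˡ (seq-ruleWireˡ G₁ H₁ v n) ⟩
      embedˡ (embedˡ (ruleWire G₁ v n))
        ≡⟨ embedˡˡ _ ⟩
      mapPort F (embedˡ (embedˡ (ruleWire G₁ v n)))
        ≡⟨ cong (mapPort F ∘ embedˡ) (par-ruleWireˡ G₁ G₂ v n) ⟨
      mapPort F (embedˡ (ruleWire G (inj₁ v) n))
        ≡⟨ cong (mapPort F) (seq-ruleWireˡ G H (inj₁ v) n) ⟨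
      mapPort F (ruleWire L (inj₁ (inj₁ v)) n) ∎
    interchange-ruleWire (inj₁ (inj₂ v)) n = begin
      ruleWire R (inj₂ (inj₁ v)) n
        ≡⟨ par-ruleWireʳ (seq G₁ H₁) (seq G₂ H₂) (inj₁ v) n ⟩
      embedʳ (length s₁) (ruleWire (seq G₂ H₂) (inj₁ v) n)
        ≡⟨ cong (embedʳ _) (seq-ruleWireˡ G₂ H₂ v n) ⟩
      embedʳ (length s₁) (embedˡ (ruleWire G₂ v n))
        ≡⟨ embedʳˡ _ ⟩
      mapPort F (embedˡ (embedʳ (length s₁) (ruleWire G₂ v n)))
        ≡⟨ cong (mapPort F ∘ embedˡ) (par-ruleWireʳ G₁ G₂ v n) ⟨
      mapPort F (embedˡ (ruleWire G (inj₂ v) n))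
        ≡⟨ cong (mapPort F) (seq-ruleWireˡ G H (inj₂ v) n) ⟨
      mapPort F (ruleWire L (inj₁ (inj₂ v)) n) ∎
    interchange-ruleWire (inj₂ (inj₁ v)) n = begin
      ruleWire R (inj₁ (inj₂ v)) n
        ≡⟨ par-ruleWireˡ (seq G₁ H₁) (seq G₂ H₂) (inj₂ v) n ⟩
      embedˡ (ruleWire (seq G₁ H₁) (inj₂ v) n)
        ≡⟨ cong embedˡ (seq-ruleWireʳ G₁ H₁ v n) ⟩
      embedˡ (resolve G₁ (ruleWire H₁ v n))
        ≡⟨ lookupℕ-agree (lhs (lab H₁ v)) (embedˡ ∘ resolve G₁) (mapPort F ∘ resolve G ∘ embedˡ)
                         (ruleFeed H₁ v) unwired refl (λ i → resolveˡ (wire H₁ (inj₂ (v , i)))) n ⟩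
      mapPort F (resolve G (embedˡ (ruleWire H₁ v n)))
        ≡⟨ cong (mapPort F ∘ resolve G) (par-ruleWireˡ H₁ H₂ v n) ⟨
      mapPort F (resolve G (ruleWire H (inj₁ v) n))
        ≡⟨ cong (mapPort F) (seq-ruleWireʳ G H (inj₁ v) n) ⟨
      mapPort F (ruleWire L (inj₂ (inj₁ v)) n) ∎
    interchange-ruleWire (inj₂ (inj₂ v)) n = begin
      ruleWire R (inj₂ (inj₂ v)) n
        ≡⟨ par-ruleWireʳ (seq G₁ H₁) (seq G₂ H₂) (inj₂ v) n ⟩
      embedʳ (length s₁) (ruleWire (seq G₂ H₂) (inj₂ v) n)
        ≡⟨ cong (embedʳ _) (seq-ruleWireʳ G₂ H₂ v n) ⟩
      embedʳ (length s₁) (resolve G₂ (ruleWire H₂ v n))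
        ≡⟨ resolveʳ (ruleWire H₂ v n) ⟩
      mapPort F (resolve G (embedʳ (length t₁) (ruleWire H₂ v n)))
        ≡⟨ cong (mapPort F ∘ resolve G) (par-ruleWireʳ H₁ H₂ v n) ⟨
      mapPort F (resolve G (ruleWire H (inj₂ v) n))
        ≡⟨ cong (mapPort F) (seq-ruleWireʳ G H (inj₂ v) n) ⟨
      mapPort F (ruleWire L (inj₂ (inj₂ v)) n) ∎

    seq-par-interchange : seq (par G₁ G₂) (par H₁ H₂) ≃ᵀ par (seq G₁ H₁) (seq G₂ H₂)
    seq-par-interchange = record
      { source≡ = refl ; target≡ = refl ; nodes = ⊎-interchange
      ; lab-to = [ [ (λ _ → refl) , (λ _ → refl) ] , [ (λ _ → refl) , (λ _ → refl) ] ]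
      ; tgtWire-to = interchange-tgtWire ; ruleWire-to = interchange-ruleWire }

  -- Permutation equivalence

  typing-unique : ∀ {γ s t s' t'} (d : γ ∶ s ⇒ t) (d' : γ ∶ s' ⇒ t') →
                  _≡_ {A = Σ Str λ s → Σ Str λ t → γ ∶ s ⇒ t} (s , t , d) (s' , t' , d')
  typing-unique ε∶         ε∶         = refl
  typing-unique (ltr∶ a)   (ltr∶ a)   = refl
  typing-unique (rul∶ ρ)   (rul∶ ρ)   = refl
  typing-unique (⊗∶ d₁ d₂) (⊗∶ e₁ e₂) with typing-unique d₁ e₁ | typing-unique d₂ e₂
  ... | refl | refl = refl
  typing-unique (⊙∶ d₁ d₂) (⊙∶ e₁ e₂) with typing-unique d₁ e₁
  ... | refl with typing-unique d₂ e₂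
  ... | refl = refl

  ⟦⟧-unique : ∀ {γ s t s' t'} (d : γ ∶ s ⇒ t) (d' : γ ∶ s' ⇒ t') → ⟦ d ⟧ ≃ᵀ ⟦ d' ⟧
  ⟦⟧-unique d d' with typing-unique d d'
  ... | refl = ≃ᵀ-refl ⟦ d ⟧

  ≈ₚ-wellTypedˡ : ∀ {γ δ} → γ ≈ₚ δ → IsProofTerm γ
  ≈ₚ-wellTypedʳ : ∀ {γ δ} → γ ≈ₚ δ → IsProofTerm δ
  ≈ₚ-wellTypedˡ (ax _ p _)         = p
  ≈ₚ-wellTypedˡ (refl p)           = p
  ≈ₚ-wellTypedˡ (sym e)            = ≈ₚ-wellTypedʳ e
  ≈ₚ-wellTypedˡ (trans e _)        = ≈ₚ-wellTypedˡ e
  ≈ₚ-wellTypedˡ (⊗-cong _ _ p _)   = p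
  ≈ₚ-wellTypedˡ (⊙-cong _ _ p _)   = p
  ≈ₚ-wellTypedʳ (ax _ _ q)         = q
  ≈ₚ-wellTypedʳ (refl q)           = q
  ≈ₚ-wellTypedʳ (sym e)            = ≈ₚ-wellTypedˡ e
  ≈ₚ-wellTypedʳ (trans _ e)        = ≈ₚ-wellTypedʳ e
  ≈ₚ-wellTypedʳ (⊗-cong _ _ _ q)   = q
  ≈ₚ-wellTypedʳ (⊙-cong _ _ _ q)   = q

  PermAx⇒≃ᵀ : ∀ {γ δ s t s' t'} → PermAx γ δ →
              (dγ : γ ∶ s ⇒ t) (dδ : δ ∶ s' ⇒ t') → ⟦ dγ ⟧ ≃ᵀ ⟦ dδ ⟧
  PermAx⇒≃ᵀ (unitˡ _)        (⊗∶ ε∶ d) dδ = ≃ᵀ-trans (par-identityˡ ⟦ d ⟧) (⟦⟧-unique d dδ)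
  PermAx⇒≃ᵀ (unitʳ _)        (⊗∶ d ε∶) dδ = ≃ᵀ-trans (par-identityʳ ⟦ d ⟧) (⟦⟧-unique d dδ)
  PermAx⇒≃ᵀ (⊗-assoc _ _ _)  (⊗∶ (⊗∶ a b) c) dδ =
    ≃ᵀ-trans (par-assoc ⟦ a ⟧ ⟦ b ⟧ ⟦ c ⟧) (⟦⟧-unique (⊗∶ a (⊗∶ b c)) dδ)
  PermAx⇒≃ᵀ (idˡ _ σ)        (⊙∶ dσ d) dδ =
    ≃ᵀ-trans (seq-identityˡ (string⇒identity σ dσ) ⟦ d ⟧) (⟦⟧-unique d dδ)
  PermAx⇒≃ᵀ (idʳ _ σ)        (⊙∶ d dσ) dδ =
    ≃ᵀ-trans (seq-identityʳ (string⇒identity σ dσ) ⟦ d ⟧) (⟦⟧-unique d dδ)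
  PermAx⇒≃ᵀ (⊙-assoc _ _ _)  (⊙∶ (⊙∶ a b) c) dδ =
    ≃ᵀ-trans (seq-assoc ⟦ a ⟧ ⟦ b ⟧ ⟦ c ⟧) (⟦⟧-unique (⊙∶ a (⊙∶ b c)) dδ)
  PermAx⇒≃ᵀ (exchange _ _ _ _) dγ (⊗∶ (⊙∶ a c) (⊙∶ b d)) =
    ≃ᵀ-trans (⟦⟧-unique dγ (⊙∶ (⊗∶ a b) (⊗∶ c d)))
             (seq-par-interchange ⟦ a ⟧ ⟦ b ⟧ ⟦ c ⟧ ⟦ d ⟧)

  ≈ₚ⇒≃ᵀ : ∀ {γ δ s t s' t'} → γ ≈ₚ δ →
          (dγ : γ ∶ s ⇒ t) (dδ : δ ∶ s' ⇒ t') → ⟦ dγ ⟧ ≃ᵀ ⟦ dδ ⟧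
  ≈ₚ⇒≃ᵀ (ax a _ _)    dγ dδ = PermAx⇒≃ᵀ a dγ dδ
  ≈ₚ⇒≃ᵀ (refl _)      dγ dδ = ⟦⟧-unique dγ dδ
  ≈ₚ⇒≃ᵀ (sym e)       dγ dδ = ≃ᵀ-sym (≈ₚ⇒≃ᵀ e dδ dγ)
  ≈ₚ⇒≃ᵀ (trans e₁ e₂) dγ dδ with ≈ₚ-wellTypedʳ e₁
  ... | _ , _ , dζ = ≃ᵀ-trans (≈ₚ⇒≃ᵀ e₁ dγ dζ) (≈ₚ⇒≃ᵀ e₂ dζ dδ)
  ≈ₚ⇒≃ᵀ (⊗-cong e₁ e₂ _ _) (⊗∶ d₁ d₂) (⊗∶ d₁′ d₂′) =
    par-cong (≈ₚ⇒≃ᵀ e₁ d₁ d₁′) (≈ₚ⇒≃ᵀ e₂ d₂ d₂′)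
  ≈ₚ⇒≃ᵀ (⊙-cong e₁ e₂ _ _) (⊙∶ d₁ d₂) (⊙∶ d₁′ d₂′) =
    seq-cong (≈ₚ⇒≃ᵀ e₁ d₁ d₁′) (≈ₚ⇒≃ᵀ e₂ d₂ d₂′)

lemma23 : (S : SRS) → let open Theory S in
    ∀ {γ δ s t s' t'} (dγ : γ ∶ s ⇒ t) (dδ : δ ∶ s' ⇒ t') →
    γ ≈ₚ δ → ⟦ dγ ⟧ᴳ ≅ᴳ ⟦ dδ ⟧ᴳ
lemma23 S dγ dδ γ≈δ = ≃ᵀ⇒≅ᴳ (≈ₚ⇒≃ᵀ γ≈δ dγ dδ)
  where open TraceGraphs S
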